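{- Let $R$ be a refinement function, $T$ a target cell selector and $\phi$ a node invariant (as defined in the context). For $G\in\mathcal{G}$ and $\pi_0\in\Pi$, let $\phi^*(G,\pi_0)=\max\{\phi(G,\pi_0,\nu):\nu \text{ is a leaf of } \mathcal{T}(G,\pi_0)\}$, let $\nu^*$ be any leaf of $\mathcal{T}(G,\pi_0)$ with $\phi(G,\pi_0,\nu^*)=\phi^*(G,\pi_0)$, and define $C(G,\pi_0)=(G,\pi_0)^{R(G,\pi_0,\nu^*)}$. Then the function $C:\mathcal{G}\times\Pi\to\mathcal{G}\times\Pi$ so defined is a canonical form.
   Context: Let $V=\{1,\dots,n\}$ and let $\mathcal{G}$ be the set of graphs with vertex set $V$. A colouring of $V$ is a surjective function $\pi:V\to\{1,\dots,k\}$ for some $k$; $\Pi$ denotes the set of all colourings. A cell of $\pi$ is a set $\pi^{ -1}(j)$; $\pi$ is discrete if every cell is a singleton, in which case $\pi$ is a permutation of $V$ (an element of $S_n$). For colourings $\pi,\pi'$, write $\pi'\preceq\pi$ if $\pi(v)<\pi(w)$ implies $\pi'(v)<\pi'(w)$ for all $v,w\in V$. The symmetric group $S_n$ acts on $V$ with $v^g$ the image of $v$ under $g$; for $W\subseteq V$, $W^g=\{w^g:w\in W\}$, and sequences are mapped componentwise; $G^g$ is the graph in which $v^g,w^g$ are adjacent iff $v,w$ are adjacent in $G$; for a colouring $\pi$, $\pi^g$ is the colouring with $\pi^g(v)=\pi(v^g)$; $(G,\pi)^g=(G^g,\pi^g)$. Coloured graphs $(G,\pi),(G',\pi')$ are isomorphic,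 written $(G,\pi)\cong(G',\pi')$, if $(G',\pi')=(G,\pi)^g$ for some $g\in S_n$. A canonical form is a function $C:\mathcal{G}\times\Pi\to\mathcal{G}\times\Pi$ such that for all $G\in\mathcal{G}$, $\pi\in\Pi$, $g\in S_n$: (C1) $C(G,\pi)\cong(G,\pi)$; (C2) $C(G^g,\pi^g)=C(G,\pi)$. $V^*$ denotes the set of finite sequences of vertices; $|\nu|$ is the length of $\nu$; for $\nu=(v_1,\dots,v_k)$ and $w\in V$, $\nu\Vert w=(v_1,\dots,v_k,w)$; "$v\in\nu$" means $v$ is a component of $\nu$. A refinement function is a function $R:\mathcal{G}\times\Pi\times V^*\to\Pi$ such that for all $G,\pi,\nu$: (R1) $R(G,\pi,\nu)\preceq\pi$; (R2) if $v\in\nu$ then $\{v\}$ is a cell of $R(G,\pi,\nu)$; (R3) for all $g\in S_n$, $R(G^g,\pi^g,\nu^g)=R(G,\pi,\nu)^g$. A target cell selector (for $R$) is a function $T:\mathcal{G}\times\Pi\times V^*\to 2^V$ such that for all $G,\pi,\nu$: (T1) if $R(G,\pi,\nu)$ is discrete then $T(G,\pi,\nu)=\emptyset$; (T2) if $R(G,\pi,\nu)$ is not discrete then $T(G,\pi,\nu)$ is a non-singleton cell of $R(G,\pi,\nu)$; (T3) for all $g\in S_n$, $T(G^g,\pi^g,\nu^g)=T(G,\pi,\nu)^g$. The search tree $\mathcal{T}(G,\pi_0)$ is the rooted tree whose nodes are elements of $V^*$: the root is $()$, and the children of a node $\nu$ are the sequences $\nu\Vert w$ for $w\in T(G,\pi_0,\nu)$.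 $\mathcal{T}(G,\pi_0,\nu)$ is the subtree consisting of $\nu$ and its descendants. A leaf is a node $\nu$ with $R(G,\pi_0,\nu)$ discrete. Let $\Omega$ be a totally ordered set. A node invariant is a function $\phi:\mathcal{G}\times\Pi\times V^*\to\Omega$ such that for all $\pi_0\in\Pi$, $G\in\mathcal{G}$ and distinct nodes $\nu,\nu'$ of $\mathcal{T}(G,\pi_0)$: ($\phi$1) if $|\nu|=|\nu'|$ and $\phi(G,\pi_0,\nu)<\phi(G,\pi_0,\nu')$, then $\phi(G,\pi_0,\nu_1)<\phi(G,\pi_0,\nu_1')$ for every leaf $\nu_1$ of $\mathcal{T}(G,\pi_0,\nu)$ and every leaf $\nu_1'$ of $\mathcal{T}(G,\pi_0,\nu')$; ($\phi$2) if $\pi=R(G,\pi_0,\nu)$ and $\pi'=R(G,\pi_0,\nu')$ are discrete, then $\phi(G,\pi_0,\nu)=\phi(G,\pi_0,\nu')$ iff $G^\pi=G^{\pi'}$ (equality of graphs); ($\phi$3) for all $g\in S_n$, $\phi(G^g,\pi_0^g,\nu^g)=\phi(G,\pi_0,\nu)$. -}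

module Defs where

open import Level using (Level; _⊔_)
open import Data.Nat using (ℕ; zero; suc; _≤_; _<_)
open import Data.Fin using (Fin; toℕ)
open import Data.Fin.Permutation using (Permutation′; _⟨$⟩ʳ_; _⟨$⟩ˡ_; inverseˡ)
open import Data.Fin.Subset using (Subset; ⁅_⁆) renaming (_∈_ to _∈ₛ_; ⊥ to ∅)
open import Data.Vec using (tabulate; lookup)
open import Data.Bool using (Bool; false)
open import Data.List using (List; []; _∷_; map; [_]; _++_; length)
open import Data.List.Membership.Propositional using () renaming (_∈_ to _∈ₗ_)
open import Data.Product using (Σ; ∃; ∃-syntax; _×_; _,_; proj₁; proj₂)
open import Relation.Binary.PropositionalEquality using (_≡_; _≢_; refl; trans; cong)
open import Relation.Binary.Bundles using (StrictTotalOrder)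
open import Relation.Nullary using (¬_)

private
  variable
    n : ℕ

_⟺_ : ∀ {a b} → Set a → Set b → Set (a ⊔ b)
A ⟺ B = (A → B) × (B → A)
infix 2 _⟺_

record Graph (n : ℕ) : Set where
  field
    adj    : Fin n → Fin n → Bool
    sym    : ∀ v w → adj v w ≡ adj w v
    irrefl : ∀ v → adj v v ≡ false
open Graph public

_≈G_ : Graph n → Graph n → Set
G ≈G H = ∀ v w → adj G v w ≡ adj H v w

record Colouring (n : ℕ) : Set where
  field
    col   : Fin n → ℕ
    k     : ℕ
    range : ∀ v → 1 ≤ col v × col v ≤ k
    onto  : ∀ j → 1 ≤ j → j ≤ k → ∃[ v ] col v ≡ j
open Colouring public

_≈C_ : Colouring n → Colouring n → Set
π ≈C π′ = ∀ v → col π v ≡ col π′ v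

_⪯_ : Colouring n → Colouring n → Set
π′ ⪯ π = ∀ v w → col π v < col π w → col π′ v < col π′ w

IsCell : Colouring n → Subset n → Set
IsCell π S = ∃[ j ] (1 ≤ j × j ≤ k π × (∀ v → v ∈ₛ S ⟺ col π v ≡ j))

IsSingleton : Subset n → Set
IsSingleton {n} S = ∃[ v ] (∀ (u : Fin n) → u ∈ₛ S ⟺ u ≡ v)

Discrete : Colouring n → Set
Discrete {n} π = ∀ (S : Subset n) → IsCell π S → IsSingleton S

-- a discrete colouring π (values in {1,…,n}) regarded as the permutation
-- v ↦ π(v) of V; with V = Fin n (0-based) this is v ↦ π(v) - 1
IsPermOf : Colouring n → Permutation′ n → Set
IsPermOf π g = ∀ v → col π v ≡ suc (toℕ (g ⟨$⟩ʳ v))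

-- Action of S_n  (v^g = g ⟨$⟩ʳ v)

-- G^g : v^g, w^g adjacent iff v, w adjacent in G
_^G_ : Graph n → Permutation′ n → Graph n
G ^G g = record
  { adj    = λ x y → adj G (g ⟨$⟩ˡ x) (g ⟨$⟩ˡ y)
  ; sym    = λ x y → sym G (g ⟨$⟩ˡ x) (g ⟨$⟩ˡ y)
  ; irrefl = λ x → irrefl G (g ⟨$⟩ˡ x)
  }

-- π^g : π^g(v^g) = π(v)
_^C_ : Colouring n → Permutation′ n → Colouring n
π ^C g = record
  { col   = λ x → col π (g ⟨$⟩ˡ x)
  ; k     = k π
  ; range = λ x → range π (g ⟨$⟩ˡ x)
  ; onto  = λ j p q → (g ⟨$⟩ʳ proj₁ (onto π j p q))
                     , trans (cong (col π) (inverseˡ g)) (proj₂ (onto π j p q))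
  }

-- W^g = { w^g : w ∈ W }  (x ∈ W^g iff x^(g⁻¹) ∈ W)
_^S_ : Subset n → Permutation′ n → Subset n
W ^S g = tabulate (λ x → lookup W (g ⟨$⟩ˡ x))

_^L_ : List (Fin n) → Permutation′ n → List (Fin n)
ν ^L g = map (g ⟨$⟩ʳ_) ν

_≅_ : Graph n × Colouring n → Graph n × Colouring n → Set
_≅_ {n} (G , π) (G′ , π′) = ∃[ g ] ((G′ ≈G (G ^G g)) × (π′ ≈C (π ^C g)))

_≈GC_ : Graph n × Colouring n → Graph n × Colouring n → Set
(G , π) ≈GC (G′ , π′) = (G ≈G G′) × (π ≈C π′)

record IsCanonicalForm {n : ℕ}
    (C : Graph n × Colouring n → Graph n × Colouring n) : Set where
  field
    C1 : ∀ G π → C (G , π) ≅ (G , π)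
    C2 : ∀ G π g → C (G ^G g , π ^C g) ≈GC C (G , π)

RefFun : ℕ → Set
RefFun n = Graph n → Colouring n → List (Fin n) → Colouring n

record IsRefinement {n : ℕ} (R : RefFun n) : Set where
  field
    R1 : ∀ G π ν → R G π ν ⪯ π
    R2 : ∀ G π ν v → v ∈ₗ ν → IsCell (R G π ν) ⁅ v ⁆
    R3 : ∀ G π ν g → R (G ^G g) (π ^C g) (ν ^L g) ≈C (R G π ν ^C g)

TargetFun : ℕ → Set
TargetFun n = Graph n → Colouring n → List (Fin n) → Subset n

record IsTargetCellSelector {n : ℕ} (R : RefFun n) (T : TargetFun n) : Set where
  field
    T1 : ∀ G π ν → Discrete (R G π ν) → T G π ν ≡ ∅
    T2 : ∀ G π ν → ¬ Discrete (R G π ν) →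
         IsCell (R G π ν) (T G π ν) × ¬ IsSingleton (T G π ν)
    T3 : ∀ G π ν g → T (G ^G g) (π ^C g) (ν ^L g) ≡ (T G π ν ^S g)

-- Desc T G π₀ ν μ : μ is a node of the subtree 𝒯(G,π₀,ν)
data Desc {n : ℕ} (T : TargetFun n) (G : Graph n) (π₀ : Colouring n)
          (ν : List (Fin n)) : List (Fin n) → Set where
  here  : Desc T G π₀ ν ν
  child : ∀ {μ w} → Desc T G π₀ ν μ → w ∈ₛ T G π₀ μ → Desc T G π₀ ν (μ ++ [ w ])

Node : {n : ℕ} → TargetFun n → Graph n → Colouring n → List (Fin n) → Set
Node T G π₀ ν = Desc T G π₀ [] ν

LeafOf : {n : ℕ} → RefFun n → TargetFun n → Graph n → Colouring n →
         List (Fin n) → List (Fin n) → Set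
LeafOf R T G π₀ ν μ = Desc T G π₀ ν μ × Discrete (R G π₀ μ)

Leaf : {n : ℕ} → RefFun n → TargetFun n → Graph n → Colouring n → List (Fin n) → Set
Leaf R T G π₀ ν = LeafOf R T G π₀ [] ν

module _ {a ℓ₁ ℓ₂} (Ω : StrictTotalOrder a ℓ₁ ℓ₂) where
  open StrictTotalOrder Ω renaming (Carrier to Ω₀; _≈_ to _≈Ω_; _<_ to _<Ω_)

  InvFun : ℕ → Set a
  InvFun n = Graph n → Colouring n → List (Fin n) → Ω₀

  record IsNodeInvariant {n : ℕ} (R : RefFun n) (T : TargetFun n) (φ : InvFun n)
      : Set (a ⊔ ℓ₁ ⊔ ℓ₂) where
    field
      φ1 : ∀ G π₀ ν ν′ → Node T G π₀ ν → Node T G π₀ ν′ → ν ≢ ν′ →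
           length ν ≡ length ν′ → φ G π₀ ν <Ω φ G π₀ ν′ →
           ∀ ν₁ ν₁′ → LeafOf R T G π₀ ν ν₁ → LeafOf R T G π₀ ν′ ν₁′ →
           φ G π₀ ν₁ <Ω φ G π₀ ν₁′
      φ2 : ∀ G π₀ ν ν′ → Node T G π₀ ν → Node T G π₀ ν′ → ν ≢ ν′ →
           Discrete (R G π₀ ν) → Discrete (R G π₀ ν′) →
           ∀ g g′ → IsPermOf (R G π₀ ν) g → IsPermOf (R G π₀ ν′) g′ →
           (φ G π₀ ν ≈Ω φ G π₀ ν′) ⟺ ((G ^G g) ≈G (G ^G g′))
      φ3 : ∀ G π₀ ν → Node T G π₀ ν → ∀ g →
           φ (G ^G g) (π₀ ^C g) (ν ^L g) ≈Ω φ G π₀ ν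

  MaxLeaf : {n : ℕ} → RefFun n → TargetFun n → InvFun n →
            Graph n → Colouring n → List (Fin n) → Set ℓ₂
  MaxLeaf R T φ G π₀ ν* =
    Leaf R T G π₀ ν* × (∀ ν → Leaf R T G π₀ ν → ¬ (φ G π₀ ν* <Ω φ G π₀ ν))

-- The function C: C(G,π₀) = (G,π₀)^{R(G,π₀,ν*)}, where the chosen leaf
-- ν* = sel G π₀ and σ G π₀ is the permutation given by the discrete
-- colouring R(G,π₀,ν*).

canon : {n : ℕ} → (Graph n → Colouring n → Permutation′ n) →
        Graph n × Colouring n → Graph n × Colouring n
canon σ (G , π₀) = (G ^G σ G π₀ , π₀ ^C σ G π₀)

module Submission where

-- The tree 𝒯(G^g, π₀^g) is the image of 𝒯(G, π₀) under g, and φ is invariant, so g maps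
-- maximal leaves to maximal leaves. Two maximal leaves carry equal invariants, hence (φ2)
-- the same relabelled graph. For the colouring, π₀ relabelled by a discrete refinement of
-- π₀ is a monotone map V → ℕ; the two relabelled colourings are monotone rearrangements
-- of each other, and a monotone rearrangement of a monotone map is the map itself.
-- Maximal leaves exist because the tree is finite: a target cell never contains a vertex
-- already individualised on the path, so nodes are repetition-free.

open import Defs hiding (sym; irrefl)
open import Level using (_⊔_; 0ℓ)
open import Data.Nat as ℕ using (ℕ; zero; suc; _+_; _<_; _≤_; _≮_; s<s⁻¹)
open import Data.Nat.Properties
  using ( ≤-antisym; n<1+n; ≮⇒≥; ≰⇒>; <⇒≱; ≤⇒≯; 1+n≰n; +-assoc; +-identityʳ; suc-injective
        ; module ≤-Reasoning)
open import Data.Fin as Fin using (Fin; toℕ; inject≤; lower) renaming (_≟_ to _≟ᶠ_)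
open import Data.Fin.Properties
  using ( any?; all?; injective⇒≤; toℕ<n; toℕ≤pred[n]; toℕ-inject≤; toℕ-injective
        ; inject≤-injective; lower-injective)
open import Data.Fin.Permutation using (Permutation′; _⟨$⟩ʳ_; _⟨$⟩ˡ_; inverseˡ; inverseʳ; flip; _∘ₚ_)
open import Data.Fin.Subset using (Subset) renaming (_∈_ to _∈ₛ_; ⊥ to ∅)
open import Data.Fin.Subset.Properties using (_∈?_; nonempty?; Empty-unique; ∉⊥; x∈⁅x⁆; x∈⁅y⁆⇒x≡y)
open import Data.Vec using (lookup)
open import Data.Vec.Properties using ([]=⇒lookup; lookup⇒[]=; lookup∘tabulate)
open import Data.List as List using (List; []; _∷_; [_]; _++_; length)
open import Data.List.Properties using (map-++; length-++) renaming (≡-dec to ≡-decᴸ)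
open import Data.List.Membership.Propositional using (_∉_)
open import Data.List.Membership.Propositional.Properties using (∈-lookup)
open import Data.List.Relation.Unary.Any using (here)
open import Data.List.Relation.Unary.All as All using ()
open import Data.List.Relation.Unary.AllPairs using ([]; _∷_)
open import Data.List.Relation.Unary.Unique.Propositional using (Unique)
open import Data.List.Relation.Unary.Unique.Propositional.Properties using (++⁺)
open import Data.Product using (∃; ∃-syntax; _×_; _,_; proj₁; proj₂; map₂)
open import Data.Sum using (_⊎_; inj₁; inj₂)
open import Data.Empty using (⊥-elim)
open import Function.Definitions using (Injective)
open import Function.Bundles using (Injection)
open import Function.Properties.Inverse using (↔⇒↣)
open import Relation.Binary.Bundles using (StrictTotalOrder)
open import Relation.Binary.Definitions using (Monotonic₁; tri<; tri≈; tri>)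
open import Relation.Binary.PropositionalEquality
  using (_≡_; refl; sym; trans; cong; cong₂; subst; subst₂; module ≡-Reasoning)
open import Relation.Nullary using (¬_; Dec; yes; no)
open import Relation.Nullary.Decidable using (_×-dec_; _→-dec_)
open import Relation.Unary using (Pred; Decidable; _⊆_; _≐_)

private
  variable
    n : ℕ

Monotone : (Fin n → ℕ) → Set
Monotone = Monotonic₁ Fin._≤_ ℕ._≤_

no-injection-into-lower : (s : Fin n → Fin n) → Injective _≡_ _≡_ s →
                          ∀ x → ¬ (∀ y → y Fin.≤ x → s y Fin.< x)
no-injection-into-lower {n} s s-injective x below = 1+n≰n (injective⇒≤ squeeze-injective)
  where
    embed : Fin (suc (toℕ x)) → Fin n
    embed i = inject≤ i (toℕ<n x)

    embed≤x : ∀ i → embed i Fin.≤ x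
    embed≤x i = subst (_≤ toℕ x) (sym (toℕ-inject≤ i (toℕ<n x))) (toℕ≤pred[n] i)

    squeeze : Fin (suc (toℕ x)) → Fin (toℕ x)
    squeeze i = lower (s (embed i)) (below (embed i) (embed≤x i))

    squeeze-injective : Injective _≡_ _≡_ squeeze
    squeeze-injective {i} {j} eq =
      inject≤-injective _ _ i j (s-injective (lower-injective (s (embed i)) (s (embed j)) eq))

-- If f x < h x then every y ≤ x has h (s y) = f y < h x, so s y < x: pigeonhole.
rearrangement-≮ : ∀ {f h : Fin n → ℕ} → Monotone f → Monotone h →
                  (s : Fin n → Fin n) → Injective _≡_ _≡_ s → (∀ x → f x ≡ h (s x)) →
                  ∀ x → f x ≮ h x
rearrangement-≮ {f = f} {h} f-mono h-mono s s-injective f≡h∘s x fx<hx =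
  no-injection-into-lower s s-injective x λ y y≤x → ≰⇒> λ x≤sy →
    <⇒≱ fx<hx (begin
      h x     ≤⟨ h-mono x≤sy ⟩
      h (s y) ≡⟨ f≡h∘s y ⟨
      f y     ≤⟨ f-mono y≤x ⟩
      f x     ∎)
  where open ≤-Reasoning

monotone-rearrangement-unique : ∀ {f h : Fin n → ℕ} → Monotone f → Monotone h →
                                (s : Permutation′ n) → (∀ x → f x ≡ h (s ⟨$⟩ʳ x)) →
                                ∀ x → f x ≡ h x
monotone-rearrangement-unique {f = f} {h} f-mono h-mono s f≡h∘s x =
  ≤-antisym (≮⇒≥ (rearrangement-≮ h-mono f-mono (flip s ⟨$⟩ʳ_) (injective (flip s)) h≡f∘s⁻¹ x))
            (≮⇒≥ (rearrangement-≮ f-mono h-mono (s ⟨$⟩ʳ_) (injective s) f≡h∘s x))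
  where
    injective : (p : Permutation′ n) → Injective _≡_ _≡_ (p ⟨$⟩ʳ_)
    injective p = Injection.injective (↔⇒↣ p)

    h≡f∘s⁻¹ : ∀ y → h y ≡ f (s ⟨$⟩ˡ y)
    h≡f∘s⁻¹ y = trans (cong h (sym (inverseʳ s))) (sym (f≡h∘s (s ⟨$⟩ˡ y)))

Unique⇒lookup-injective : ∀ {a} {A : Set a} {xs : List A} → Unique xs →
                          Injective _≡_ _≡_ (List.lookup xs)
Unique⇒lookup-injective (_   ∷ _)   {Fin.zero}  {Fin.zero}  _  = refl
Unique⇒lookup-injective (x∉ ∷ _)    {Fin.zero}  {Fin.suc j} eq =
  ⊥-elim (All.lookup x∉ (∈-lookup j) eq)
Unique⇒lookup-injective (x∉ ∷ _)    {Fin.suc i} {Fin.zero}  eq =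
  ⊥-elim (All.lookup x∉ (∈-lookup i) (sym eq))
Unique⇒lookup-injective (_   ∷ xs!) {Fin.suc i} {Fin.suc j} eq =
  cong Fin.suc (Unique⇒lookup-injective xs! eq)

Unique⇒length≤ : {xs : List (Fin n)} → Unique xs → length xs ≤ n
Unique⇒length≤ xs! = injective⇒≤ (Unique⇒lookup-injective xs!)

∈-^S⁻ : ∀ {S : Subset n} (g : Permutation′ n) {x} → x ∈ₛ S ^S g → g ⟨$⟩ˡ x ∈ₛ S
∈-^S⁻ {S = S} g {x} x∈ = lookup⇒[]= (g ⟨$⟩ˡ x) S
  (trans (sym (lookup∘tabulate (λ y → lookup S (g ⟨$⟩ˡ y)) x)) ([]=⇒lookup x∈))

∈-^S⁺ : ∀ {S : Subset n} (g : Permutation′ n) {x} → x ∈ₛ S → g ⟨$⟩ʳ x ∈ₛ S ^S g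
∈-^S⁺ {S = S} g {x} x∈ = lookup⇒[]= (g ⟨$⟩ʳ x) (S ^S g)
  (trans (lookup∘tabulate (λ y → lookup S (g ⟨$⟩ˡ y)) (g ⟨$⟩ʳ x))
         (trans (cong (lookup S) (inverseˡ g)) ([]=⇒lookup x∈)))

^S-≡∅ : ∀ {S : Subset n} (g : Permutation′ n) → (S ^S g ≡ ∅) ⟺ (S ≡ ∅)
^S-≡∅ g = (λ e → Empty-unique λ (x , x∈) → ∉⊥ (subst (_ ∈ₛ_) e (∈-^S⁺ g x∈)))
        , (λ e → Empty-unique λ (x , x∈) → ∉⊥ (subst (_ ∈ₛ_) e (∈-^S⁻ g x∈)))

singleton? : (S : Subset n) → Dec (IsSingleton S)
singleton? S = any? λ v → all? λ u → ((u ∈? S) →-dec (u ≟ᶠ v)) ×-dec ((u ≟ᶠ v) →-dec (u ∈? S))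

cell-nonempty : ∀ {π : Colouring n} {S} → IsCell π S → ∃ (_∈ₛ S)
cell-nonempty {π = π} (j , 1≤j , j≤k , S≡π⁻¹j) =
  let v , πv≡j = onto π j 1≤j j≤k in v , proj₂ (S≡π⁻¹j v) πv≡j

cell-⊆ : ∀ {π : Colouring n} {S S′ v} → IsCell π S → IsCell π S′ → v ∈ₛ S → v ∈ₛ S′ →
         ∀ {u} → u ∈ₛ S → u ∈ₛ S′
cell-⊆ (j , _ , _ , S≡π⁻¹j) (j′ , _ , _ , S′≡π⁻¹j′) v∈S v∈S′ u∈S =
  proj₂ (S′≡π⁻¹j′ _) (begin
    _ ≡⟨ proj₁ (S≡π⁻¹j _) u∈S ⟩
    j ≡⟨ proj₁ (S≡π⁻¹j _) v∈S ⟨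
    _ ≡⟨ proj₁ (S′≡π⁻¹j′ _) v∈S′ ⟩
    j′ ∎)
  where open ≡-Reasoning

IsPermOf-unique : ∀ {ρ : Colouring n} {p q} → IsPermOf ρ p → IsPermOf ρ q →
                  ∀ x → p ⟨$⟩ˡ x ≡ q ⟨$⟩ˡ x
IsPermOf-unique {p = p} {q} ρ≡p ρ≡q x = begin
  p ⟨$⟩ˡ x                           ≡⟨ inverseˡ q ⟨
  q ⟨$⟩ˡ (q ⟨$⟩ʳ (p ⟨$⟩ˡ x))         ≡⟨ cong (q ⟨$⟩ˡ_) (p≡q (p ⟨$⟩ˡ x)) ⟨
  q ⟨$⟩ˡ (p ⟨$⟩ʳ (p ⟨$⟩ˡ x))         ≡⟨ cong (q ⟨$⟩ˡ_) (inverseʳ p) ⟩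
  q ⟨$⟩ˡ x                           ∎
  where
    open ≡-Reasoning
    p≡q : ∀ v → p ⟨$⟩ʳ v ≡ q ⟨$⟩ʳ v
    p≡q v = toℕ-injective (suc-injective (trans (sym (ρ≡p v)) (ρ≡q v)))

IsPermOf-^C : ∀ {ρ : Colouring n} {p} (g : Permutation′ n) →
              IsPermOf ρ p → IsPermOf (ρ ^C g) (flip g ∘ₚ p)
IsPermOf-^C g ρ≡p x = ρ≡p (g ⟨$⟩ˡ x)

^G-cong : ∀ (G : Graph n) {p q} → (∀ x → p ⟨$⟩ˡ x ≡ q ⟨$⟩ˡ x) → (G ^G p) ≈G (G ^G q)
^G-cong G p≡q v w = cong₂ (adj G) (p≡q v) (p≡q w)

refinement-sorts : ∀ {ρ π : Colouring n} {p} → ρ ⪯ π → IsPermOf ρ p → Monotone (col (π ^C p))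
refinement-sorts {ρ = ρ} {π} {p} ρ⪯π ρ≡p {x} {y} x≤y = ≮⇒≥ λ πy<πx →
  ≤⇒≯ x≤y (subst₂ _<_ (cong toℕ (inverseʳ p)) (cong toℕ (inverseʳ p)) (s<s⁻¹
    (subst₂ _<_ (ρ≡p (p ⟨$⟩ˡ y)) (ρ≡p (p ⟨$⟩ˡ x)) (ρ⪯π (p ⟨$⟩ˡ y) (p ⟨$⟩ˡ x) πy<πx))))

module Maxima {a ℓ₁ ℓ₂} (Ω : StrictTotalOrder a ℓ₁ ℓ₂) where

  open StrictTotalOrder Ω renaming (Carrier to Ω₀; _≈_ to _≈Ω_; _<_ to _<Ω_; trans to <-trans)

  ≮-trans : ∀ {x y z} → ¬ x <Ω y → ¬ y <Ω z → ¬ x <Ω z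
  ≮-trans {y = y} {z} x≮y y≮z x<z with compare y z
  ... | tri< y<z _ _ = y≮z y<z
  ... | tri≈ _ y≈z _ = x≮y (proj₁ <-resp-≈ (Eq.sym y≈z) x<z)
  ... | tri> _ _ z<y = x≮y (<-trans x<z z<y)

  ≮-resp-≈ : ∀ {x x′ y y′} → x ≈Ω x′ → y ≈Ω y′ → ¬ x′ <Ω y′ → ¬ x <Ω y
  ≮-resp-≈ x≈x′ y≈y′ x′≮y′ x<y = x′≮y′ (proj₁ <-resp-≈ y≈y′ (proj₂ <-resp-≈ x≈x′ x<y))

  ≮∧≯⇒≈ : ∀ {x y} → ¬ x <Ω y → ¬ y <Ω x → x ≈Ω y
  ≮∧≯⇒≈ {x} {y} x≮y y≮x with compare x y
  ... | tri< x<y _ _ = ⊥-elim (x≮y x<y)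
  ... | tri≈ _ x≈y _ = x≈y
  ... | tri> _ _ y<x = ⊥-elim (y≮x y<x)

  module _ {b} {X : Set b} (h : X → Ω₀) where

    IsMaxOf : ∀ {p} → Pred X p → Pred X (b ⊔ p ⊔ ℓ₂)
    IsMaxOf A x = A x × (∀ y → A y → ¬ h x <Ω h y)

    IsMaxOf-≐ : ∀ {p q} {A : Pred X p} {B : Pred X q} → A ≐ B → IsMaxOf A ⊆ IsMaxOf B
    IsMaxOf-≐ (A⊆B , B⊆A) (Ax , x-max) = A⊆B Ax , λ y By → x-max y (B⊆A By)

    max-of-maxima : ∀ {m p q} {P : Pred (Fin m) p} → Decidable P → (L : Fin m → Pred X q) →
                    (∀ w → P w → ∃ (IsMaxOf (L w))) → ∃ P →
                    ∃ (IsMaxOf (λ x → ∃ λ w → P w × L w x))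
    max-of-maxima {m = zero} _ _ _ (() , _)
    max-of-maxima {m = suc m} P? L maxima (w₀ , pw₀)
      with P? Fin.zero | any? (λ w → P? (Fin.suc w))
    ... | no ¬p₀ | no ¬p₊ with w₀
    ...   | Fin.zero  = ⊥-elim (¬p₀ pw₀)
    ...   | Fin.suc w = ⊥-elim (¬p₊ (w , pw₀))
    max-of-maxima P? L maxima _ | yes p₀ | no ¬p₊ =
      let x₀ , Lx₀ , x₀-max = maxima Fin.zero p₀ in
      x₀ , (Fin.zero , p₀ , Lx₀) , λ { y (Fin.zero , _ , Ly) → x₀-max y Ly
                                     ; y (Fin.suc w , pw , _) → ⊥-elim (¬p₊ (w , pw)) }
    max-of-maxima P? L maxima _ | no ¬p₀ | yes p₊ =
      let x , (w , pw , Lx) , x-max = max-of-maxima (λ w → P? (Fin.suc w)) (λ w → L (Fin.suc w))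
                                        (λ w → maxima (Fin.suc w)) p₊ in
      x , (Fin.suc w , pw , Lx) , λ { y (Fin.zero , p₀ , _) → ⊥-elim (¬p₀ p₀)
                                    ; y (Fin.suc w , pw , Ly) → x-max y (w , pw , Ly) }
    max-of-maxima P? L maxima _ | yes p₀ | yes p₊
      with maxima Fin.zero p₀
         | max-of-maxima (λ w → P? (Fin.suc w)) (λ w → L (Fin.suc w))
                         (λ w → maxima (Fin.suc w)) p₊
    ... | x₀ , Lx₀ , x₀-max | x , (w , pw , Lx) , x-max with h x₀ <? h x
    ...   | yes x₀<x =
      x , (Fin.suc w , pw , Lx) , λ { y (Fin.zero , _ , Ly) x<y → x₀-max y Ly (<-trans x₀<x x<y)
                                    ; y (Fin.suc w′ , pw′ , Ly) → x-max y (w′ , pw′ , Ly) }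
    ...   | no x₀≮x =
      x₀ , (Fin.zero , p₀ , Lx₀) , λ { y (Fin.zero , _ , Ly) → x₀-max y Ly
                                     ; y (Fin.suc w′ , pw′ , Ly) →
                                         ≮-trans x₀≮x (x-max y (w′ , pw′ , Ly)) }

module SearchTree {a ℓ₁ ℓ₂} (Ω : StrictTotalOrder a ℓ₁ ℓ₂) {n : ℕ}
    {R : RefFun n} {T : TargetFun n} {φ : InvFun Ω n}
    (isRefinement : IsRefinement R) (isTarget : IsTargetCellSelector R T)
    (isInvariant : IsNodeInvariant Ω R T φ) where

  open StrictTotalOrder Ω using (irrefl; module Eq) renaming (_<_ to _<Ω_; _≈_ to _≈Ω_)
  open IsRefinement isRefinement
  open IsTargetCellSelector isTarget
  open IsNodeInvariant isInvariant
  open Maxima Ω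

  target-inhabited⇒¬Discrete : ∀ G π ν {w} → w ∈ₛ T G π ν → ¬ Discrete (R G π ν)
  target-inhabited⇒¬Discrete G π ν w∈T disc = ∉⊥ (subst (_ ∈ₛ_) (T1 G π ν disc) w∈T)

  -- The target cell is a non-singleton cell, while every vertex of ν is a singleton cell.
  target-∉ : ∀ G π ν {w} → w ∈ₛ T G π ν → w ∉ ν
  target-∉ G π ν {w} w∈T w∈ν = T-non-singleton (w , λ u → T⊆⁅w⁆ , λ { refl → w∈T })
    where
      T-cell : IsCell (R G π ν) (T G π ν)
      T-cell = proj₁ (T2 G π ν (target-inhabited⇒¬Discrete G π ν w∈T))

      T-non-singleton : ¬ IsSingleton (T G π ν)
      T-non-singleton = proj₂ (T2 G π ν (target-inhabited⇒¬Discrete G π ν w∈T))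

      T⊆⁅w⁆ : ∀ {u} → u ∈ₛ T G π ν → u ≡ w
      T⊆⁅w⁆ u∈T = x∈⁅y⁆⇒x≡y w (cell-⊆ {π = R G π ν} T-cell (R2 G π ν w w∈ν) w∈T (x∈⁅x⁆ w) u∈T)

  Node⇒Unique : ∀ {G π ν} → Node T G π ν → Unique ν
  Node⇒Unique here = []
  Node⇒Unique {G} {π} (child {ν} d w∈T) =
    ++⁺ (Node⇒Unique d) (All.[] ∷ []) λ { (w∈ν , here refl) → target-∉ G π ν w∈T w∈ν }

  Desc-trans : ∀ {G π ν ν′ μ} → Desc T G π ν ν′ → Desc T G π ν′ μ → Desc T G π ν μ
  Desc-trans d here = d
  Desc-trans d (child d′ w∈T) = child (Desc-trans d d′) w∈T

  Desc-view : ∀ {G π ν μ} → Desc T G π ν μ →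
              μ ≡ ν ⊎ ∃ λ w → w ∈ₛ T G π ν × Desc T G π (ν ++ [ w ]) μ
  Desc-view here = inj₁ refl
  Desc-view (child d w∈T) with Desc-view d
  ... | inj₁ refl = inj₂ (_ , w∈T , here)
  ... | inj₂ (w′ , w′∈T , d′) = inj₂ (w′ , w′∈T , child d′ w∈T)

  Discrete⇔T≡∅ : ∀ G π ν → Discrete (R G π ν) ⟺ (T G π ν ≡ ∅)
  Discrete⇔T≡∅ G π ν = T1 G π ν , T≡∅⇒Discrete
    where
      T≡∅⇒Discrete : T G π ν ≡ ∅ → Discrete (R G π ν)
      T≡∅⇒Discrete T≡∅ S S-cell with singleton? S
      ... | yes S-singleton = S-singleton
      ... | no ¬S-singleton
        with cell-nonempty {π = R G π ν} (proj₁ (T2 G π ν λ disc → ¬S-singleton (disc S S-cell)))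
      ...   | _ , v∈T = ⊥-elim (∉⊥ (subst (_ ∈ₛ_) T≡∅ v∈T))

  MaxLeafOf : Graph n → Colouring n → List (Fin n) → Pred (List (Fin n)) ℓ₂
  MaxLeafOf G π ν = IsMaxOf (φ G π) (LeafOf R T G π ν)

  -- fuel: a node has at most n entries, so n − length ν more levels always suffice
  max-leaf-below : ∀ {G π} f ν → Node T G π ν → n ℕ.< length ν + f → ∃ (MaxLeafOf G π ν)
  max-leaf-below zero ν ν∈𝒯 n<ν =
    ⊥-elim (<⇒≱ (subst (n ℕ.<_) (+-identityʳ (length ν)) n<ν)
                (Unique⇒length≤ (Node⇒Unique ν∈𝒯)))
  max-leaf-below {G} {π} (suc f) ν ν∈𝒯 n<ν with nonempty? (T G π ν)
  ... | no T-empty = ν , (here , proj₂ (Discrete⇔T≡∅ G π ν) (Empty-unique T-empty)) , ν-max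
    where
      ν-max : ∀ μ → LeafOf R T G π ν μ → ¬ φ G π ν <Ω φ G π μ
      ν-max μ (d , _) with Desc-view d
      ... | inj₁ refl = irrefl Eq.refl
      ... | inj₂ (w , w∈T , _) = ⊥-elim (T-empty (w , w∈T))
  ... | yes T-inhabited =
    map₂ (IsMaxOf-≐ (φ G π) (child-leaves⊆leaves , leaves⊆child-leaves))
         (max-of-maxima (φ G π) (_∈? T G π ν) child-leaves child-leaves-max T-inhabited)
    where
      child-leaves : Fin n → Pred (List (Fin n)) 0ℓ
      child-leaves w = LeafOf R T G π (ν ++ [ w ])

      child-leaves-max : ∀ w → w ∈ₛ T G π ν → ∃ (MaxLeafOf G π (ν ++ [ w ]))
      child-leaves-max w w∈T =
        max-leaf-below f (ν ++ [ w ]) (child ν∈𝒯 w∈T) (subst (n ℕ.<_) length-step n<ν)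
        where
          length-step : length ν + suc f ≡ length (ν ++ [ w ]) + f
          length-step = sym (trans (cong (_+ f) (length-++ ν)) (+-assoc (length ν) 1 f))

      child-leaves⊆leaves : ∀ {μ} → (∃ λ w → w ∈ₛ T G π ν × child-leaves w μ) → LeafOf R T G π ν μ
      child-leaves⊆leaves (w , w∈T , d , μ-discrete) = Desc-trans (child here w∈T) d , μ-discrete

      leaves⊆child-leaves : ∀ {μ} → LeafOf R T G π ν μ → ∃ λ w → w ∈ₛ T G π ν × child-leaves w μ
      leaves⊆child-leaves (d , μ-discrete) with Desc-view d
      ... | inj₁ refl = ⊥-elim (target-inhabited⇒¬Discrete G π ν (proj₂ T-inhabited) μ-discrete)
      ... | inj₂ (w , w∈T , d′) = w , w∈T , d′ , μ-discrete

  max-leaf : ∀ G π → ∃ (MaxLeaf Ω R T φ G π)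
  max-leaf G π = max-leaf-below (suc n) [] here (n<1+n n)

  module _ (G : Graph n) (π : Colouring n) (g : Permutation′ n) where

    Node-^ : ∀ {ν} → Node T G π ν → Node T (G ^G g) (π ^C g) (ν ^L g)
    Node-^ here = here
    Node-^ (child {ν} {w} d w∈T) =
      subst (Node T (G ^G g) (π ^C g)) (sym (map-++ (g ⟨$⟩ʳ_) ν [ w ]))
        (child (Node-^ d) (subst (_ ∈ₛ_) (sym (T3 G π ν g)) (∈-^S⁺ g w∈T)))

    Node-^⁻ : ∀ {ν′} → Node T (G ^G g) (π ^C g) ν′ → ∃ λ ν → Node T G π ν × ν ^L g ≡ ν′
    Node-^⁻ here = [] , here , refl
    Node-^⁻ (child {w = w} d w∈T′) with Node-^⁻ d
    ... | ν , ν∈𝒯 , refl =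
      ν ++ [ g ⟨$⟩ˡ w ] ,
      child ν∈𝒯 (∈-^S⁻ g (subst (w ∈ₛ_) (T3 G π ν g) w∈T′)) ,
      trans (map-++ (g ⟨$⟩ʳ_) ν [ g ⟨$⟩ˡ w ]) (cong (λ v → (ν ^L g) ++ [ v ]) (inverseʳ g))

    Discrete-^ : ∀ ν → Discrete (R G π ν) ⟺ Discrete (R (G ^G g) (π ^C g) (ν ^L g))
    Discrete-^ ν =
      (λ disc → proj₂ (Discrete⇔T≡∅ _ _ _)
                  (trans (T3 G π ν g) (proj₂ (^S-≡∅ g) (T1 G π ν disc))))
      , λ disc → proj₂ (Discrete⇔T≡∅ G π ν)
                  (proj₁ (^S-≡∅ g) (trans (sym (T3 G π ν g)) (T1 _ _ _ disc)))

    MaxLeaf-^ : ∀ {ν} → MaxLeaf Ω R T φ G π ν → MaxLeaf Ω R T φ (G ^G g) (π ^C g) (ν ^L g)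
    MaxLeaf-^ {ν} ((ν∈𝒯 , ν-discrete) , ν-max) =
      (Node-^ ν∈𝒯 , proj₁ (Discrete-^ ν) ν-discrete) , ν^g-max
      where
        ν^g-max : ∀ ν′ → Leaf R T (G ^G g) (π ^C g) ν′ →
                  ¬ φ (G ^G g) (π ^C g) (ν ^L g) <Ω φ (G ^G g) (π ^C g) ν′
        ν^g-max ν′ (ν′∈𝒯 , ν′-discrete) with Node-^⁻ ν′∈𝒯
        ... | μ , μ∈𝒯 , refl =
          ≮-resp-≈ (φ3 G π ν ν∈𝒯 g) (φ3 G π μ μ∈𝒯 g)
                   (ν-max μ (μ∈𝒯 , proj₂ (Discrete-^ μ) ν′-discrete))

  MaxLeaf-≈ : ∀ {G π ν ν′} → MaxLeaf Ω R T φ G π ν → MaxLeaf Ω R T φ G π ν′ →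
              φ G π ν ≈Ω φ G π ν′
  MaxLeaf-≈ {ν = ν} {ν′} (ν-leaf , ν-max) (ν′-leaf , ν′-max) =
    ≮∧≯⇒≈ (ν-max ν′ ν′-leaf) (ν′-max ν ν-leaf)

  MaxLeaf-relabel : ∀ {G π ν ν′ p q} → MaxLeaf Ω R T φ G π ν → MaxLeaf Ω R T φ G π ν′ →
                    IsPermOf (R G π ν) p → IsPermOf (R G π ν′) q → (G ^G p) ≈G (G ^G q)
  MaxLeaf-relabel {G} {π} {ν} {ν′} {p} {q} ν-max ν′-max ν≡p ν′≡q with ≡-decᴸ _≟ᶠ_ ν ν′
  ... | yes refl = ^G-cong G {p} {q} (IsPermOf-unique {ρ = R G π ν} {p} {q} ν≡p ν′≡q)
  ... | no ν≢ν′ =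
    let (ν∈𝒯 , ν-discrete) , _ = ν-max ; (ν′∈𝒯 , ν′-discrete) , _ = ν′-max in
    proj₁ (φ2 G π ν ν′ ν∈𝒯 ν′∈𝒯 ν≢ν′ ν-discrete ν′-discrete p q ν≡p ν′≡q)
          (MaxLeaf-≈ ν-max ν′-max)

  canonical-form : (sel : Graph n → Colouring n → List (Fin n)) →
                   (∀ G π → MaxLeaf Ω R T φ G π (sel G π)) →
                   (σ : Graph n → Colouring n → Permutation′ n) →
                   (∀ G π → IsPermOf (R G π (sel G π)) (σ G π)) →
                   IsCanonicalForm (canon σ)
  canonical-form sel sel-max σ σ-perm = record { C1 = isomorphic ; C2 = invariant }
    where
      isomorphic : ∀ G π → canon σ (G , π) ≅ (G , π)
      isomorphic G π = flip (σ G π)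
                     , (λ v w → sym (cong₂ (adj G) (inverseˡ (σ G π)) (inverseˡ (σ G π))))
                     , (λ v → sym (cong (col π) (inverseˡ (σ G π))))

      invariant : ∀ G π g → canon σ (G ^G g , π ^C g) ≈GC canon σ (G , π)
      invariant G π g = graph , colouring
        where
          G′ : Graph n
          G′ = G ^G g

          π′ : Colouring n
          π′ = π ^C g

          ν* ν′ : List (Fin n)
          ν* = sel G π
          ν′ = sel G′ π′

          σ* σ′ : Permutation′ n
          σ* = σ G π
          σ′ = σ G′ π′

          ν*^g-perm : IsPermOf (R G′ π′ (ν* ^L g)) (flip g ∘ₚ σ*)
          ν*^g-perm v = trans (R3 G π ν* g v) (IsPermOf-^C {ρ = R G π ν*} {σ*} g (σ-perm G π) v)

          graph : (G′ ^G σ′) ≈G (G ^G σ*)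
          graph v w =
            trans (MaxLeaf-relabel {p = σ′} {q = flip g ∘ₚ σ*}
                                   (sel-max G′ π′) (MaxLeaf-^ G π g (sel-max G π))
                                   (σ-perm G′ π′) ν*^g-perm v w)
                  (cong₂ (adj G) (inverseˡ g) (inverseˡ g))

          colouring : (π′ ^C σ′) ≈C (π ^C σ*)
          colouring = monotone-rearrangement-unique
            (refinement-sorts {ρ = R G′ π′ ν′} {π′} {σ′} (R1 G′ π′ ν′) (σ-perm G′ π′))
            (refinement-sorts {ρ = R G π ν*} {π} {σ*} (R1 G π ν*) (σ-perm G π))
            (flip σ′ ∘ₚ flip g ∘ₚ σ*)
            (λ x → sym (cong (col π) (inverseˡ σ*)))

lemma2p4 : ∀ {a ℓ₁ ℓ₂} (Ω : StrictTotalOrder a ℓ₁ ℓ₂) (n : ℕ)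
    (R : RefFun n) (T : TargetFun n) (φ : InvFun Ω n) →
    IsRefinement R → IsTargetCellSelector R T → IsNodeInvariant Ω R T φ →
    (∀ (G : Graph n) (π₀ : Colouring n) → ∃[ ν* ] MaxLeaf Ω R T φ G π₀ ν*)
    × (∀ (sel : Graph n → Colouring n → List (Fin n)) →
       (∀ G π₀ → MaxLeaf Ω R T φ G π₀ (sel G π₀)) →
       ∀ (σ : Graph n → Colouring n → Permutation′ n) →
       (∀ G π₀ → IsPermOf (R G π₀ (sel G π₀)) (σ G π₀)) →
       IsCanonicalForm (canon σ))
lemma2p4 Ω n R T φ isRefinement isTarget isInvariant = max-leaf , canonical-form
  where open SearchTree Ω isRefinement isTarget isInvariant
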